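{- For any heap implementation in the canonical framework and any sequence of heap operations starting with no heaps, the number of insertion links is at most the number of insertions.
   Context: Canonical heap framework: a heap holding items with keys from a totally ordered set is either empty or a single heap-ordered rooted tree whose nodes are the items. A link of two roots makes the root of smaller key (ties arbitrary) the parent of the other; a cut removes a child from its parent. Operations: make-heap creates an empty heap; find-min returns the root; insert$(H,e)$ links $e$ with the root of $H$ if $H$ is nonempty, otherwise $e$ becomes the root; meld$(H_1,H_2)$ returns the other heap if one is empty, otherwise links their roots; decrease-key$(H,e,k)$ sets the key of $e$ to $k$ and, if $e$ is not the root, cuts $e$ from its parent and links $e$ with the root; delete-min deletes the root and repeatedly links pairs of the resulting roots (the children of the deleted root) until only one remains, in an order determined by the implementation. An insertion link is a link done during an insert or a meld. -}

-- An "implementation" is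
-- captured by quantifying over ALL runs: ties in a link may be broken either
-- way, and delete-min may link the remaining roots in pairs in ANY order;
-- every concrete implementation produces one of these runs.

module Defs where

open import Relation.Binary.Bundles using (TotalOrder)

module Heaps {c ℓ₁ ℓ₂} (O : TotalOrder c ℓ₁ ℓ₂) where

  open import Level using (_⊔_)
  open import Data.Nat using (ℕ; zero; suc; _+_)
  open import Data.List using (List; []; _∷_)
  open import Data.List.Relation.Unary.All using (All)
  open import Data.List.Relation.Binary.Permutation.Propositional using (_↭_)
  open import Data.Maybe using (Maybe; just; nothing)
  open import Relation.Binary.PropositionalEquality using (_≡_)
  open import Relation.Nullary using (¬_)

  open TotalOrder O renaming (Carrier to Key)

  record Item : Set c where
    constructor item
    field
      name : ℕ
      key  : Key
  open Item public

  data Tree : Set c where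
    node : Item → List Tree → Tree

  Heap : Set c
  Heap = Maybe Tree

  mutual
    data _∈T_ (n : ℕ) : Tree → Set c where
      at-root : ∀ {x ts} → name x ≡ n → n ∈T node x ts
      below   : ∀ {x ts} → n ∈L ts → n ∈T node x ts

    data _∈L_ (n : ℕ) : List Tree → Set c where
      hd : ∀ {t ts} → n ∈T t → n ∈L (t ∷ ts)
      tl : ∀ {t ts} → n ∈L ts → n ∈L (t ∷ ts)

  data _∈H_ (n : ℕ) : Heap → Set c where
    inH : ∀ {t} → n ∈T t → n ∈H just t

  Fresh : ℕ → List Heap → Set c
  Fresh n s = All (λ h → ¬ (n ∈H h)) s

  data Link : Tree → Tree → Tree → Set (c ⊔ ℓ₂) where
    left  : ∀ {x xs y ys} → key x ≤ key y →
            Link (node x xs) (node y ys) (node x (node y ys ∷ xs))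
    right : ∀ {x xs y ys} → key y ≤ key x →
            Link (node x xs) (node y ys) (node y (node x xs ∷ ys))

  -- Cutting the (non-root) node named n from its parent:
  -- CutL n ts ts' s : removing subtree s (rooted at n) from the forest ts gives ts'.
  data CutL (n : ℕ) : List Tree → List Tree → Tree → Set c where
    here  : ∀ {y ys ts} → name y ≡ n → CutL n (node y ys ∷ ts) ts (node y ys)
    there : ∀ {t ts ts' s} → CutL n ts ts' s → CutL n (t ∷ ts) (t ∷ ts') s
    down  : ∀ {x cs cs' ts s} → CutL n cs cs' s →
            CutL n (node x cs ∷ ts) (node x cs' ∷ ts) s

  data Cut (n : ℕ) : Tree → Tree → Tree → Set c where
    cut : ∀ {x cs cs' s} → CutL n cs cs' s → Cut n (node x cs) (node x cs') s

  -- insert(H, e); last index = number of links performed.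
  data Insert : Item → Heap → Heap → ℕ → Set (c ⊔ ℓ₂) where
    ins-empty    : ∀ {e} → Insert e nothing (just (node e [])) 0
    ins-nonempty : ∀ {e t t'} → Link (node e []) t t' → Insert e (just t) (just t') 1

  data Meld : Heap → Heap → Heap → ℕ → Set (c ⊔ ℓ₂) where
    meld-emptyˡ : ∀ {h} → Meld nothing h h 0
    meld-emptyʳ : ∀ {t} → Meld (just t) nothing (just t) 0
    meld-link   : ∀ {a b t} → Link a b t → Meld (just a) (just b) (just t) 1

  data DecreaseKey (n : ℕ) (k : Key) : Heap → Heap → Set (c ⊔ ℓ₂) where
    dk-root    : ∀ {x cs} → name x ≡ n → k ≤ key x →
                 DecreaseKey n k (just (node x cs)) (just (node (item (name x) k) cs))
    dk-nonroot : ∀ {t t₀ y ys t'} → Cut n t t₀ (node y ys) → k ≤ key y →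
                 Link (node (item (name y) k) ys) t₀ t' →
                 DecreaseKey n k (just t) (just t')

  data LinkAll : List Tree → Heap → Set (c ⊔ ℓ₂) where
    none : LinkAll [] nothing
    one  : ∀ {t} → LinkAll (t ∷ []) (just t)
    pair : ∀ {ts a b rest t h} → ts ↭ (a ∷ b ∷ rest) → Link a b t →
           LinkAll (t ∷ rest) h → LinkAll ts h

  data DeleteMin : Heap → Heap → Set (c ⊔ ℓ₂) where
    del : ∀ {x cs h} → LinkAll cs h → DeleteMin (just (node x cs)) h

  -- Run s i l : starting with no heaps, some sequence of operations leads to
  -- the collection of heaps s, having done i insertions and l insertion links.
  -- A heap operand is selected from the collection via a permutation.
  data Run : List Heap → ℕ → ℕ → Set (c ⊔ ℓ₁ ⊔ ℓ₂) where
    start        : Run [] 0 0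
    make-heap    : ∀ {s i l} → Run s i l → Run (nothing ∷ s) i l
    find-min     : ∀ {s i l h rest} → Run s i l → s ↭ (h ∷ rest) → Run s i l
    insert       : ∀ {s i l h rest e h' k} → Run s i l → s ↭ (h ∷ rest) →
                   Fresh (name e) s → Insert e h h' k →
                   Run (h' ∷ rest) (suc i) (l + k)
    meld         : ∀ {s i l h₁ h₂ rest h k} → Run s i l → s ↭ (h₁ ∷ h₂ ∷ rest) →
                   Meld h₁ h₂ h k → Run (h ∷ rest) i (l + k)
    decrease-key : ∀ {s i l h rest n k h'} → Run s i l → s ↭ (h ∷ rest) →
                   DecreaseKey n k h h' → Run (h' ∷ rest) i l
    delete-min   : ∀ {s i l h rest h'} → Run s i l → s ↭ (h ∷ rest) →
                   DeleteMin h h' → Run (h' ∷ rest) i l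

-- Take the number of nonempty heaps as potential.  An insertion raises it by
-- one unless it performs a link; a meld link lowers it by one; decrease-key
-- and delete-min never raise it.  So insertion links plus nonempty heaps
-- never exceed insertions.
module Submission where

open import Defs
open import Relation.Binary.Bundles using (TotalOrder)
open import Data.Nat using (ℕ; suc; _+_; _≤_; z≤n; s≤s)
open import Data.Nat.Properties
  using (≤-reflexive; ≤-trans; +-assoc; +-monoʳ-≤; +-monoˡ-≤; m≤m+n;
         +-commutativeSemigroup; module ≤-Reasoning)
open import Algebra.Properties.CommutativeSemigroup +-commutativeSemigroup
  using (x∙yz≈y∙xz)
open import Data.Nat.ListAction using (sum)
open import Data.Nat.ListAction.Properties using (sum-↭)
open import Data.Maybe using (just; nothing)
open import Data.List using (List; map)
open import Data.List.Relation.Binary.Permutation.Propositional using (_↭_)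
open import Data.List.Relation.Binary.Permutation.Propositional.Properties
  using (map⁺)
open import Relation.Binary.PropositionalEquality using (_≡_; refl; cong; sym)

module _ {c ℓ₁ ℓ₂} (O : TotalOrder c ℓ₁ ℓ₂) where
  open Heaps O

  size : Heap → ℕ
  size nothing  = 0
  size (just _) = 1

  size≤1 : ∀ h → size h ≤ 1
  size≤1 nothing  = z≤n
  size≤1 (just _) = s≤s z≤n

  nonemptyCount : List Heap → ℕ
  nonemptyCount s = sum (map size s)

  nonemptyCount-↭ : ∀ {s t} → s ↭ t → nonemptyCount s ≡ nonemptyCount t
  nonemptyCount-↭ p = sum-↭ (map⁺ size p)

  bound-↭ : ∀ {s t l i} → s ↭ t → l + nonemptyCount s ≤ i → l + nonemptyCount t ≤ i
  bound-↭ {l = l} p bound =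
    ≤-trans (≤-reflexive (cong (l +_) (sym (nonemptyCount-↭ p)))) bound

  insert-size : ∀ {e h h' k} → Insert e h h' k → k + size h' ≡ suc (size h)
  insert-size ins-empty        = refl
  insert-size (ins-nonempty _) = refl

  meld-size : ∀ {h₁ h₂ h k} → Meld h₁ h₂ h k → k + size h ≡ size h₁ + size h₂
  meld-size meld-emptyˡ   = refl
  meld-size meld-emptyʳ   = refl
  meld-size (meld-link _) = refl

  decreaseKey-size : ∀ {n k h h'} → DecreaseKey n k h h' → size h' ≡ size h
  decreaseKey-size (dk-root _ _)      = refl
  decreaseKey-size (dk-nonroot _ _ _) = refl

  deleteMin-size : ∀ {h h'} → DeleteMin h h' → size h' ≤ size h
  deleteMin-size {h' = h'} (del _) = size≤1 h'

  shrink-head : ∀ {l a b r i} → b ≤ a → l + (a + r) ≤ i → l + (b + r) ≤ i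
  shrink-head {l} {r = r} b≤a = ≤-trans (+-monoʳ-≤ l (+-monoˡ-≤ r b≤a))

  -- An operation with j insertions and k links that replaces selected heaps
  -- of total size a by one of size b preserves the invariant.
  potential-step : ∀ {l k j a b r i} → k + b ≤ j + a → l + (a + r) ≤ i →
                   (l + k) + (b + r) ≤ j + i
  potential-step {l} {k} {j} {a} {b} {r} {i} kb≤ja la≤i = begin
    (l + k) + (b + r)  ≡⟨ +-assoc l k (b + r) ⟩
    l + (k + (b + r))  ≡⟨ cong (l +_) (+-assoc k b r) ⟨
    l + ((k + b) + r)  ≤⟨ +-monoʳ-≤ l (+-monoˡ-≤ r kb≤ja) ⟩
    l + ((j + a) + r)  ≡⟨ cong (l +_) (+-assoc j a r) ⟩
    l + (j + (a + r))  ≡⟨ x∙yz≈y∙xz l j (a + r) ⟩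
    j + (l + (a + r))  ≤⟨ +-monoʳ-≤ j la≤i ⟩
    j + i              ∎
    where open ≤-Reasoning

  links+nonempty≤insertions : ∀ {s i l} → Run s i l → l + nonemptyCount s ≤ i
  links+nonempty≤insertions start = z≤n
  links+nonempty≤insertions (make-heap run) = links+nonempty≤insertions run
  links+nonempty≤insertions (find-min run _) = links+nonempty≤insertions run
  links+nonempty≤insertions (insert {l = l} {h} {rest} {h' = h'} {k} run p _ ins) =
    potential-step {l} {k} {1} {size h} {size h'} {nonemptyCount rest}
      (≤-reflexive (insert-size ins)) (bound-↭ p (links+nonempty≤insertions run))
  links+nonempty≤insertions (meld {l = l} {h₁} {h₂} {rest} {h} {k} run p m) =
    potential-step {l} {k} {0} {size h₁ + size h₂} {size h} {nonemptyCount rest}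
      (≤-reflexive (meld-size m))
      (≤-trans (≤-reflexive (cong (l +_) (+-assoc (size h₁) (size h₂) _)))
               (bound-↭ p (links+nonempty≤insertions run)))
  links+nonempty≤insertions (decrease-key {l = l} {rest = rest} run p d) =
    shrink-head {l} {r = nonemptyCount rest}
      (≤-reflexive (decreaseKey-size d)) (bound-↭ p (links+nonempty≤insertions run))
  links+nonempty≤insertions (delete-min {l = l} {rest = rest} run p d) =
    shrink-head {l} {r = nonemptyCount rest}
      (deleteMin-size d) (bound-↭ p (links+nonempty≤insertions run))

lemma4p1 : ∀ {c ℓ₁ ℓ₂} (O : TotalOrder c ℓ₁ ℓ₂) {s i l} →
             Heaps.Run O s i l → l ≤ i
lemma4p1 O {s} {l = l} run =
  ≤-trans (m≤m+n l (nonemptyCount O s)) (links+nonempty≤insertions O run)
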